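{- Let $(\{u_0,u_1,\dots,u_{2k}\},\{v_0,v_1,\dots,v_{2k}\})$ be an asteroid in a bipartite graph $H$. Then each of the sets $\{u_0,u_1,u_{k+1}\}$, $\{u_0,u_{2k},u_k\}$, $\{v_0,v_1,v_{k+1}\}$ and $\{v_0,v_{2k},v_k\}$ is a special triple of $H$.
   Context: Asteroid: let $k\ge1$ and $H$ bipartite with bipartition classes $X,Y$ (in either order). Ordered sets $U=\{u_0,\dots,u_{2k}\}\subseteq X$, $V=\{v_0,\dots,v_{2k}\}\subseteq Y$ with $u_iv_i\in E(H)$ for all $i$ form a (special edge) asteroid $(U,V)$ of order $2k+1$ if for every $i\in\{0,\dots,2k\}$ there is a $u_i$-$u_{i+1}$-path $P_{i,i+1}$ in $H$ (indices modulo $2k+1$) such that (a) there are no edges between $\{u_i,v_i\}$ and $\{v_{i+k},v_{i+k+1}\}\cup V(P_{i+k,i+k+1})$, and (b) there are no edges between $\{u_0,v_0\}$ and $\{v_1,\dots,v_{2k}\}\cup\bigcup_{i=1}^{2k-1}V(P_{i,i+1})$. A set $T$ of three vertices of $H$ is a special triple if there exists an asteroid $(\{u'_0,\dots,u'_{2k'}\},\{v'_0,\dots,v'_{2k'}\})$ in $H$ (for some $k'\ge1$, with the first set in either bipartition class) such that $T=\{u'_0,u'_1,u'_{k'+1}\}$. -}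

module Defs where

open import Data.Nat using (ℕ; zero; suc; _+_; _*_; _≤_; _<_; _%_)
open import Data.Nat.DivMod using (m%n<n)
open import Data.Fin using (Fin; toℕ; fromℕ<; fromℕ)
open import Data.Bool using (Bool; not)
open import Data.Product using (Σ; ∃; _×_; _,_)
open import Data.Sum using (_⊎_)
open import Data.Empty using (⊥)
open import Relation.Nullary using (¬_)
open import Relation.Binary.PropositionalEquality using (_≡_; _≢_)
open import Function.Definitions using (Injective)
open import Level using (0ℓ)

record BipartiteGraph (n : ℕ) : Set₁ where
  field
    E      : Fin n → Fin n → Set
    sym    : ∀ {x y} → E x y → E y x
    irrefl : ∀ {x} → ¬ E x x
    side   : Fin n → Bool
    bip    : ∀ {x y} → E x y → side x ≢ side y

open BipartiteGraph public

record Path {n : ℕ} (H : BipartiteGraph n) (x y : Fin n) : Set where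
  field
    len   : ℕ
    vtx   : Fin (suc len) → Fin n
    inj   : Injective _≡_ _≡_ vtx
    start : vtx Data.Fin.zero ≡ x
    end   : vtx (fromℕ len) ≡ y
    adj   : ∀ (j : Fin len) → E H (vtx (Data.Fin.inject₁ j)) (vtx (Data.Fin.suc j))

open Path public

_∈P_ : ∀ {n} {H : BipartiteGraph n} {x y : Fin n} → Fin n → Path H x y → Set
w ∈P P = ∃ λ j → vtx P j ≡ w

[_]mod : ∀ {m} → ℕ → Fin (suc m)
[_]mod {m} a = fromℕ< (m%n<n a (suc m))

NoEdges : ∀ {n} → BipartiteGraph n → (Fin n → Set) → (Fin n → Set) → Set
NoEdges H A B = ∀ a b → A a → B b → ¬ E H a b

pair : ∀ {n} → Fin n → Fin n → Fin n → Set
pair a b x = x ≡ a ⊎ x ≡ b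

-- (special edge) asteroid (U,V) of order 2k+1, with U = {u 0 , ... , u 2k}
-- and V = {v 0 , ... , v 2k} (indices in Fin (2k+1), arithmetic mod 2k+1).
record Asteroid {n : ℕ} (H : BipartiteGraph n) (k : ℕ)
                (u v : Fin (suc (2 * k)) → Fin n) : Set where
  field
    k≥1    : 1 ≤ k
    u-inj  : Injective _≡_ _≡_ u
    v-inj  : Injective _≡_ _≡_ v
    cls    : Bool
    u-side : ∀ i → side H (u i) ≡ cls
    v-side : ∀ i → side H (v i) ≡ not cls
    uv-edge : ∀ i → E H (u i) (v i)
    P      : ∀ i → Path H (u i) (u [ toℕ i + 1 ]mod)
    cond-a : ∀ i →
      let j = [ toℕ i + k ]mod in
      NoEdges H (pair (u i) (v i))
        (λ w → (w ≡ v j ⊎ w ≡ v [ toℕ i + k + 1 ]mod) ⊎ w ∈P P j)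
    cond-b : NoEdges H (pair (u [ 0 ]mod) (v [ 0 ]mod))
        (λ w → (Σ (Fin (suc (2 * k))) λ i → 1 ≤ toℕ i × w ≡ v i)
             ⊎ (Σ (Fin (suc (2 * k))) λ i →
                  (1 ≤ toℕ i × toℕ i < 2 * k) × w ∈P P i))

SameTriple : ∀ {n} → (a b c a' b' c' : Fin n) → Set
SameTriple a b c a' b' c' =
  ∀ x → ((x ≡ a ⊎ x ≡ b ⊎ x ≡ c) → (x ≡ a' ⊎ x ≡ b' ⊎ x ≡ c'))
      × ((x ≡ a' ⊎ x ≡ b' ⊎ x ≡ c') → (x ≡ a ⊎ x ≡ b ⊎ x ≡ c))

SpecialTriple : ∀ {n} → BipartiteGraph n → Fin n → Fin n → Fin n → Set
SpecialTriple {n} H a b c =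
  Σ ℕ λ k' → Σ (Fin (suc (2 * k')) → Fin n) λ u' → Σ (Fin (suc (2 * k')) → Fin n) λ v' →
    Asteroid H k' u' v' ×
    SameTriple a b c (u' [ 0 ]mod) (u' [ 1 ]mod) (u' [ k' + 1 ]mod)

-- An asteroid can be re-indexed along i ↦ −i (mod 2k+1), taking as new paths the reversed
-- paths P_{−i−1,−i}; and the roles of U and V can be exchanged, taking as path from v_i to
-- v_{i+1} the path P_{i,i+1} extended by the edges v_i u_i and u_{i+1} v_{i+1} (and shortened
-- to a simple path). Each new path only uses vertices that conditions (a) and (b) of the old
-- asteroid already keep apart from the relevant u_i, v_i, so both operations yield asteroids.
-- Reversal turns {u_0, u_1, u_{k+1}} into {u_0, u_{2k}, u_k}, exchange turns it into
-- {v_0, v_1, v_{k+1}}, and reversing the exchanged asteroid gives {v_0, v_{2k}, v_k}.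
module Submission where

open import Defs renaming (sym to E-sym)
open import Data.Nat using (ℕ; zero; suc; _+_; _*_; _∸_; _≤_; _<_; _%_; s≤s; z≤n)
open import Data.Nat.Properties
  using (≤-pred; +-suc; m+[n∸m]≡n; +-cancelˡ-≡; +-identityʳ; ≤-trans; ≤-reflexive; +-monoʳ-≤; +-∸-assoc;
         +-comm; +-assoc; m∸n+n≡m; <⇒≤; ∸-monoʳ-<; ∸-monoˡ-≤; m<n⇒0<n∸m; *-monoʳ-≤; m<n⇒m<1+n; ≤-antisym; ≮⇒≥; _<?_)
open import Data.Nat.DivMod using (m%n<n; n%n≡0; m%n%n≡m%n; %-distribˡ-+; m<n⇒m%n≡m; [m+kn]%n≡m%n)
open import Data.Nat.Tactic.RingSolver using (solve-∀)
open import Data.Fin as Fin using (Fin; toℕ; fromℕ<; fromℕ; inject₁; opposite; _≟_)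
open import Data.Fin.Properties
  using (toℕ-injective; toℕ-fromℕ<; toℕ<n; toℕ-inject₁; toℕ-fromℕ; toℕ≤pred[n]; opposite-prop; opposite-involutive; any?)
open import Data.Bool using (not)
open import Data.Bool.Properties using (not-involutive)
open import Data.Product using (Σ; ∃-syntax; _×_; _,_; proj₁; proj₂)
open import Data.Sum using (_⊎_; inj₁; inj₂; [_,_]′)
open import Data.Empty using (⊥-elim)
open import Function using (_∘_)
open import Function.Definitions using (Injective)
open import Level using (0ℓ)
open import Relation.Nullary using (¬_; yes; no)
open import Relation.Binary.Bundles using (Setoid)
open import Relation.Binary.Structures using (IsEquivalence)
open import Relation.Binary.PropositionalEquality
import Relation.Binary.Reasoning.Setoid as SetoidReasoning

module _ {n : ℕ} {H : BipartiteGraph n} where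

  infix 4 _⊆P_

  _⊆P_ : ∀ {x y x′ y′} → Path H x′ y′ → Path H x y → Set
  R ⊆P Q = ∀ {w} → w ∈P R → w ∈P Q

  PathWithin : ∀ {x y} → Path H x y → Fin n → Fin n → Set
  PathWithin Q a b = Σ (Path H a b) (_⊆P Q)

  vtx-adjacent : ∀ {x y} (Q : Path H x y) {a b : Fin (suc (len Q))} →
                 toℕ b ≡ suc (toℕ a) → E H (vtx Q a) (vtx Q b)
  vtx-adjacent Q {a} {b} b≡1+a =
    subst₂ (E H) (cong (vtx Q) inject₁-t≡a) (cong (vtx Q) suc-t≡b) (adj Q t)
    where
    a<len : toℕ a < len Q
    a<len = ≤-pred (subst (_< suc (len Q)) b≡1+a (toℕ<n b))
    t = fromℕ< a<len
    inject₁-t≡a : inject₁ t ≡ a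
    inject₁-t≡a = toℕ-injective (trans (toℕ-inject₁ t) (toℕ-fromℕ< a<len))
    suc-t≡b : Fin.suc t ≡ b
    suc-t≡b = toℕ-injective (trans (cong suc (toℕ-fromℕ< a<len)) (sym b≡1+a))

  Neighbours : ∀ {l} → Fin l → Fin l → Set
  Neighbours a b = toℕ b ≡ suc (toℕ a) ⊎ toℕ a ≡ suc (toℕ b)

  reindex : ∀ {x y x′ y′} (Q : Path H x y) (m : ℕ) (f : Fin (suc m) → Fin (suc (len Q))) →
            Injective _≡_ _≡_ f →
            (∀ (t : Fin m) → Neighbours (f (inject₁ t)) (f (Fin.suc t))) →
            vtx Q (f Fin.zero) ≡ x′ → vtx Q (f (fromℕ m)) ≡ y′ → PathWithin Q x′ y′
  reindex Q m f f-inj f-steps start′ end′ =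
    record { len = m ; vtx = λ t → vtx Q (f t) ; inj = λ e → f-inj (inj Q e)
           ; start = start′ ; end = end′ ; adj = step }
    , λ { (t , e) → f t , e }
    where
    step : ∀ t → E H (vtx Q (f (inject₁ t))) (vtx Q (f (Fin.suc t)))
    step t with f-steps t
    ... | inj₁ e = vtx-adjacent Q e
    ... | inj₂ e = E-sym H (vtx-adjacent Q e)

  opposite-fromℕ : ∀ m → opposite (fromℕ m) ≡ Fin.zero
  opposite-fromℕ zero = refl
  opposite-fromℕ (suc m) = cong inject₁ (opposite-fromℕ m)

  opposite-neighbours : ∀ {m} (t : Fin m) → Neighbours (opposite (inject₁ t)) (opposite (Fin.suc t))
  opposite-neighbours {m} t = inj₂ (begin
    toℕ (opposite (inject₁ t))       ≡⟨ opposite-prop (inject₁ t) ⟩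
    m ∸ toℕ (inject₁ t)              ≡⟨ cong (m ∸_) (toℕ-inject₁ t) ⟩
    m ∸ toℕ t                        ≡⟨ +-∸-assoc 1 (toℕ<n t) ⟩
    suc (m ∸ suc (toℕ t))            ≡⟨ cong suc (opposite-prop (Fin.suc t)) ⟨
    suc (toℕ (opposite (Fin.suc t))) ∎)
    where open ≡-Reasoning

  reverse : ∀ {x y} (Q : Path H x y) → PathWithin Q y x
  reverse Q = reindex Q (len Q) opposite opposite-injective opposite-neighbours
                (end Q) (trans (cong (vtx Q) (opposite-fromℕ (len Q))) (start Q))
    where
    opposite-injective : Injective _≡_ _≡_ opposite
    opposite-injective {a} {b} e =
      trans (sym (opposite-involutive a)) (trans (cong opposite e) (opposite-involutive b))

  suffix : ∀ {x y} (Q : Path H x y) (j : Fin (suc (len Q))) → PathWithin Q (vtx Q j) y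
  suffix Q j = reindex Q m shift shift-injective shift-neighbours
                 (cong (vtx Q) (toℕ-injective (trans (toℕ-fromℕ< (j+t<1+len Fin.zero)) (+-identityʳ (toℕ j)))))
                 (trans (cong (vtx Q) (toℕ-injective shift-last)) (end Q))
    where
    m = len Q ∸ toℕ j
    j≤len : toℕ j ≤ len Q
    j≤len = toℕ≤pred[n] j
    j+t<1+len : (t : Fin (suc m)) → toℕ j + toℕ t < suc (len Q)
    j+t<1+len t = s≤s (≤-trans (+-monoʳ-≤ (toℕ j) (toℕ≤pred[n] t)) (≤-reflexive (m+[n∸m]≡n j≤len)))
    shift : Fin (suc m) → Fin (suc (len Q))
    shift t = fromℕ< (j+t<1+len t)
    toℕ-shift : ∀ t → toℕ (shift t) ≡ toℕ j + toℕ t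
    toℕ-shift t = toℕ-fromℕ< (j+t<1+len t)
    shift-injective : Injective _≡_ _≡_ shift
    shift-injective {a} {b} e = toℕ-injective (+-cancelˡ-≡ (toℕ j) _ _
      (trans (sym (toℕ-shift a)) (trans (cong toℕ e) (toℕ-shift b))))
    shift-neighbours : ∀ t → Neighbours (shift (inject₁ t)) (shift (Fin.suc t))
    shift-neighbours t = inj₁ (begin
      toℕ (shift (Fin.suc t))       ≡⟨ toℕ-shift (Fin.suc t) ⟩
      toℕ j + suc (toℕ t)           ≡⟨ +-suc (toℕ j) (toℕ t) ⟩
      suc (toℕ j + toℕ t)           ≡⟨ cong (λ i → suc (toℕ j + i)) (toℕ-inject₁ t) ⟨
      suc (toℕ j + toℕ (inject₁ t)) ≡⟨ cong suc (toℕ-shift (inject₁ t)) ⟨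
      suc (toℕ (shift (inject₁ t))) ∎)
      where open ≡-Reasoning
    shift-last : toℕ (shift (fromℕ m)) ≡ toℕ (fromℕ (len Q))
    shift-last = begin
      toℕ (shift (fromℕ m))   ≡⟨ toℕ-shift (fromℕ m) ⟩
      toℕ j + toℕ (fromℕ m)   ≡⟨ cong (toℕ j +_) (toℕ-fromℕ m) ⟩
      toℕ j + m               ≡⟨ m+[n∸m]≡n j≤len ⟩
      len Q                   ≡⟨ toℕ-fromℕ (len Q) ⟨
      toℕ (fromℕ (len Q))     ∎
      where open ≡-Reasoning

  cons : ∀ {x a b} (Q : Path H a b) → E H x a → ¬ x ∈P Q →
         Σ (Path H x b) λ R → ∀ {w} → w ∈P R → w ≡ x ⊎ w ∈P Q
  cons {x} {b = b} Q x~a x∉Q = R , ∈-R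
    where
    vtx′ : Fin (suc (suc (len Q))) → Fin n
    vtx′ Fin.zero = x
    vtx′ (Fin.suc t) = vtx Q t
    vtx′-injective : Injective _≡_ _≡_ vtx′
    vtx′-injective {Fin.zero} {Fin.zero} _ = refl
    vtx′-injective {Fin.zero} {Fin.suc t} e = ⊥-elim (x∉Q (t , sym e))
    vtx′-injective {Fin.suc t} {Fin.zero} e = ⊥-elim (x∉Q (t , e))
    vtx′-injective {Fin.suc s} {Fin.suc t} e = cong Fin.suc (inj Q e)
    adj′ : ∀ (t : Fin (suc (len Q))) → E H (vtx′ (inject₁ t)) (vtx′ (Fin.suc t))
    adj′ Fin.zero = subst (E H x) (sym (start Q)) x~a
    adj′ (Fin.suc t) = adj Q t
    R : Path H x b
    R = record { len = suc (len Q) ; vtx = vtx′ ; inj = vtx′-injective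
               ; start = refl ; end = end Q ; adj = adj′ }
    ∈-R : ∀ {w} → w ∈P R → w ≡ x ⊎ w ∈P Q
    ∈-R (Fin.zero , e) = inj₁ (sym e)
    ∈-R (Fin.suc t , e) = inj₂ (t , e)

  -- If x already lies on Q, the path is cut short at x instead.
  prepend : ∀ {x a b} (Q : Path H a b) → E H x a →
            Σ (Path H x b) λ R → ∀ {w} → w ∈P R → w ≡ x ⊎ w ∈P Q
  prepend {x} Q x~a with any? (λ j → vtx Q j ≟ x)
  ... | yes (j , refl) = let (R , R⊆Q) = suffix Q j in R , λ w∈R → inj₂ (R⊆Q w∈R)
  ... | no x∉Q = cons Q x~a x∉Q

  -- Abstract: clients use only the vertex bound, and unfolding the construction is very costly.
  abstract
    extend : ∀ {x a b y} (Q : Path H a b) → E H x a → E H b y →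
             Σ (Path H x y) λ R → ∀ {w} → w ∈P R → w ≡ x ⊎ w ≡ y ⊎ w ∈P Q
    extend {x} {b = b} {y} Q x~a b~y = proj₁ R₄ , ∈-R₄
      where
      R₁ : Σ (Path H x b) λ R → ∀ {w} → w ∈P R → w ≡ x ⊎ w ∈P Q
      R₁ = prepend Q x~a
      R₂ : PathWithin (proj₁ R₁) b x
      R₂ = reverse (proj₁ R₁)
      R₃ : Σ (Path H y x) λ R → ∀ {w} → w ∈P R → w ≡ y ⊎ w ∈P proj₁ R₂
      R₃ = prepend (proj₁ R₂) (E-sym H b~y)
      R₄ : PathWithin (proj₁ R₃) x y
      R₄ = reverse (proj₁ R₃)
      ∈-R₄ : ∀ {w} → w ∈P proj₁ R₄ → w ≡ x ⊎ w ≡ y ⊎ w ∈P Q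
      ∈-R₄ w∈R₄ = [ inj₂ ∘ inj₁ , (λ w∈R₂ → [ inj₁ , inj₂ ∘ inj₂ ]′ (proj₂ R₁ (proj₂ R₂ w∈R₂))) ]′
                    (proj₂ R₃ (proj₂ R₄ w∈R₄))

  start-∈P : ∀ {x y} (Q : Path H x y) → x ∈P Q
  start-∈P Q = Fin.zero , start Q

  end-∈P : ∀ {x y} (Q : Path H x y) → y ∈P Q
  end-∈P Q = fromℕ (len Q) , end Q

module Residues (m : ℕ) where

  infix 4 _≈_

  record _≈_ (a b : ℕ) : Set where
    constructor mod-eq
    field %-eq : a % suc m ≡ b % suc m

  open _≈_

  ≈-isEquivalence : IsEquivalence _≈_
  ≈-isEquivalence = record
    { refl  = mod-eq refl
    ; sym   = λ a≈b → mod-eq (sym (%-eq a≈b))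
    ; trans = λ a≈b b≈c → mod-eq (trans (%-eq a≈b) (%-eq b≈c))
    }

  ≈-setoid : Setoid 0ℓ 0ℓ
  ≈-setoid = record { isEquivalence = ≈-isEquivalence }

  open IsEquivalence ≈-isEquivalence public
    using () renaming (refl to ≈-refl; sym to ≈-sym; trans to ≈-trans; reflexive to ≈-reflexive)

  module ≈-Reasoning = SetoidReasoning ≈-setoid

  +-cong : ∀ {a b c d} → a ≈ b → c ≈ d → a + c ≈ b + d
  +-cong {a} {b} {c} {d} (mod-eq a≡b) (mod-eq c≡d) = mod-eq (begin
    (a + c) % suc m                   ≡⟨ %-distribˡ-+ a c (suc m) ⟩
    (a % suc m + c % suc m) % suc m   ≡⟨ cong₂ (λ x y → (x + y) % suc m) a≡b c≡d ⟩
    (b % suc m + d % suc m) % suc m   ≡⟨ %-distribˡ-+ b d (suc m) ⟨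
    (b + d) % suc m                   ∎)
    where open ≡-Reasoning

  +-multiple : ∀ a c → a + c * suc m ≈ a
  +-multiple a c = mod-eq ([m+kn]%n≡m%n a c (suc m))

  +-cancelʳ : ∀ {a b} c → a + c ≈ b + c → a ≈ b
  +-cancelʳ {a} {b} c a+c≈b+c = begin
    a                     ≈⟨ +-multiple a c ⟨
    a + c * suc m         ≡⟨ regroup a c m ⟩
    (a + c) + m * c       ≈⟨ +-cong a+c≈b+c ≈-refl ⟩
    (b + c) + m * c       ≡⟨ regroup b c m ⟨
    b + c * suc m         ≈⟨ +-multiple b c ⟩
    b                     ∎
    where
    open ≈-Reasoning
    regroup : ∀ x y z → x + y * suc z ≡ (x + y) + z * y
    regroup = solve-∀

  modulus≈0 : suc m ≈ 0
  modulus≈0 = mod-eq (n%n≡0 (suc m))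

  toℕ-[]mod : ∀ a → toℕ ([_]mod {m} a) ≈ a
  toℕ-[]mod a = mod-eq (trans (cong (_% suc m) (toℕ-fromℕ< (m%n<n a (suc m)))) (m%n%n≡m%n a (suc m)))

  toℕ-[]mod-< : ∀ {a} → a < suc m → toℕ ([_]mod {m} a) ≡ a
  toℕ-[]mod-< {a} a<1+m = trans (toℕ-fromℕ< (m%n<n a (suc m))) (m<n⇒m%n≡m a<1+m)

  toℕ-[suc]mod : ∀ {i : Fin (suc m)} → toℕ i < m → toℕ ([_]mod {m} (toℕ i + 1)) ≡ suc (toℕ i)
  toℕ-[suc]mod {i} i<m =
    trans (toℕ-[]mod-< (subst (_< suc m) (+-comm 1 (toℕ i)) (s≤s i<m))) (+-comm (toℕ i) 1)

  toℕ-injective-≈ : ∀ {i j : Fin (suc m)} → toℕ i ≈ toℕ j → i ≡ j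
  toℕ-injective-≈ {i} {j} (mod-eq i≡j) =
    toℕ-injective (trans (sym (m<n⇒m%n≡m (toℕ<n i))) (trans i≡j (m<n⇒m%n≡m (toℕ<n j))))

  []mod-cong : ∀ {a b} → a ≈ b → [_]mod {m} a ≡ [ b ]mod
  []mod-cong {a} {b} a≈b = toℕ-injective-≈ (≈-trans (toℕ-[]mod a) (≈-trans a≈b (≈-sym (toℕ-[]mod b))))

  []mod-toℕ : ∀ (i : Fin (suc m)) → [ toℕ i ]mod ≡ i
  []mod-toℕ i = toℕ-injective-≈ (toℕ-[]mod (toℕ i))

  []mod-+ : ∀ a c → [_]mod {m} (toℕ ([_]mod {m} a) + c) ≡ [ a + c ]mod
  []mod-+ a c = []mod-cong (+-cong (toℕ-[]mod a) ≈-refl)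

  -- Abstract: everything about neg is derived from neg-inverse and toℕ-neg.
  abstract
    neg : Fin (suc m) → Fin (suc m)
    neg i = [ suc m ∸ toℕ i ]mod

    neg-inverse : ∀ i → toℕ (neg i) + toℕ i ≈ 0
    neg-inverse i = begin
      toℕ (neg i) + toℕ i       ≈⟨ +-cong (toℕ-[]mod (suc m ∸ toℕ i)) ≈-refl ⟩
      (suc m ∸ toℕ i) + toℕ i   ≡⟨ m∸n+n≡m (<⇒≤ (toℕ<n i)) ⟩
      suc m                     ≈⟨ modulus≈0 ⟩
      0                         ∎
      where open ≈-Reasoning

    toℕ-neg : ∀ {i} → 0 < toℕ i → toℕ (neg i) ≡ suc m ∸ toℕ i
    toℕ-neg {i} 0<i = toℕ-[]mod-< (∸-monoʳ-< 0<i (<⇒≤ (toℕ<n i)))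

  neg-unique : ∀ {b} i → b + toℕ i ≈ 0 → neg i ≡ [ b ]mod
  neg-unique {b} i b+i≈0 = toℕ-injective-≈ (begin
    toℕ (neg i)         ≈⟨ +-cancelʳ (toℕ i) (≈-trans (neg-inverse i) (≈-sym b+i≈0)) ⟩
    b                   ≈⟨ toℕ-[]mod b ⟨
    toℕ ([_]mod {m} b)  ∎)
    where open ≈-Reasoning

  neg-[]mod : ∀ a b → b + a ≈ 0 → neg [ a ]mod ≡ [ b ]mod
  neg-[]mod a b b+a≈0 = neg-unique [ a ]mod (≈-trans (+-cong ≈-refl (toℕ-[]mod a)) b+a≈0)

  neg-+ : ∀ i c d → c + d ≡ suc m → neg [ toℕ i + c ]mod ≡ [ toℕ (neg i) + d ]mod
  neg-+ i c d c+d≡1+m = neg-[]mod (toℕ i + c) (toℕ (neg i) + d) (begin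
    (toℕ (neg i) + d) + (toℕ i + c)   ≡⟨ regroup (toℕ (neg i)) (toℕ i) c d ⟩
    (toℕ (neg i) + toℕ i) + (c + d)   ≡⟨ cong (toℕ (neg i) + toℕ i +_) c+d≡1+m ⟩
    (toℕ (neg i) + toℕ i) + suc m     ≈⟨ +-cong ≈-refl modulus≈0 ⟩
    (toℕ (neg i) + toℕ i) + 0         ≡⟨ +-identityʳ _ ⟩
    toℕ (neg i) + toℕ i               ≈⟨ neg-inverse i ⟩
    0                                 ∎)
    where
    open ≈-Reasoning
    regroup : ∀ a b c d → (a + d) + (b + c) ≡ (a + b) + (c + d)
    regroup = solve-∀

  neg-involutive : ∀ i → neg (neg i) ≡ i
  neg-involutive i = trans (neg-unique (neg i) (≈-trans (≈-reflexive (+-comm (toℕ i) _)) (neg-inverse i)))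
                           ([]mod-toℕ i)

  neg-injective : ∀ {i j} → neg i ≡ neg j → i ≡ j
  neg-injective {i} {j} e = trans (sym (neg-involutive i)) (trans (cong neg e) (neg-involutive j))

  neg-positive : ∀ {i} → 0 < toℕ i → 0 < toℕ (neg i)
  neg-positive {i} 0<i = subst (0 <_) (sym (toℕ-neg 0<i)) (m<n⇒0<n∸m (toℕ<n i))

pair-swap : ∀ {n} {a b x : Fin n} → pair a b x → pair b a x
pair-swap (inj₁ x≡a) = inj₂ x≡a
pair-swap (inj₂ x≡b) = inj₁ x≡b

same-triple : ∀ {n} {a b c a′ b′ c′ : Fin n} → a ≡ a′ → b ≡ b′ → c ≡ c′ → SameTriple a b c a′ b′ c′
same-triple refl refl refl x = (λ x∈ → x∈) , (λ x∈ → x∈)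

module Indices (k : ℕ) where

  open Residues (2 * k) public

  Inner : Fin (suc (2 * k)) → Set
  Inner i = 1 ≤ toℕ i × toℕ i < 2 * k

  neg-0 : neg [ 0 ]mod ≡ [ 0 ]mod
  neg-0 = neg-[]mod 0 0 ≈-refl

  neg-1 : neg [ 1 ]mod ≡ [ 2 * k ]mod
  neg-1 = neg-[]mod 1 (2 * k) (≈-trans (≈-reflexive (+-comm (2 * k) 1)) modulus≈0)

  k+[k+1]≡1+2k : k + (k + 1) ≡ suc (2 * k)
  k+[k+1]≡1+2k = identity k
    where
    identity : ∀ k → k + (k + 1) ≡ suc (2 * k)
    identity = solve-∀

  neg-k+1 : neg [ k + 1 ]mod ≡ [ k ]mod
  neg-k+1 = neg-[]mod (k + 1) k (≈-trans (≈-reflexive k+[k+1]≡1+2k) modulus≈0)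

  neg-suc : ∀ i → [ toℕ (neg [ toℕ i + 1 ]mod) + 1 ]mod ≡ neg i
  neg-suc i = sym (neg-unique i (begin
    (toℕ (neg [ toℕ i + 1 ]mod) + 1) + toℕ i      ≡⟨ identity (toℕ (neg [ toℕ i + 1 ]mod)) (toℕ i) ⟩
    toℕ (neg [ toℕ i + 1 ]mod) + (toℕ i + 1)      ≈⟨ +-cong ≈-refl (toℕ-[]mod (toℕ i + 1)) ⟨
    toℕ (neg [ toℕ i + 1 ]mod) + toℕ ([_]mod {2 * k} (toℕ i + 1)) ≈⟨ neg-inverse [ toℕ i + 1 ]mod ⟩
    0                                             ∎))
    where
    open ≈-Reasoning
    identity : ∀ a b → (a + 1) + b ≡ a + (b + 1)
    identity = solve-∀

  neg-+k : ∀ i → neg [ toℕ i + k ]mod ≡ [ toℕ (neg i) + k + 1 ]mod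
  neg-+k i = trans (neg-+ i k (k + 1) k+[k+1]≡1+2k) (cong [_]mod (sym (+-assoc (toℕ (neg i)) k 1)))

  neg-+k+1 : ∀ i → neg [ toℕ i + k + 1 ]mod ≡ [ toℕ (neg i) + k ]mod
  neg-+k+1 i = trans (cong (λ a → neg [ a ]mod) (+-assoc (toℕ i) k 1))
                     (neg-+ i (k + 1) k (trans (+-comm (k + 1) k) k+[k+1]≡1+2k))

  suc-positive : ∀ {i} → toℕ i < 2 * k → 1 ≤ toℕ ([_]mod {2 * k} (toℕ i + 1))
  suc-positive i<2k = subst (1 ≤_) (sym (toℕ-[suc]mod i<2k)) (s≤s z≤n)

  -- On inner indices, i ↦ -(i + 1) is 2k - i.
  neg-inner : ∀ {i} → Inner i → Inner (neg [ toℕ i + 1 ]mod)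
  neg-inner {i} (0<i , i<2k) =
      subst (1 ≤_) (sym toℕ-neg-suc) (m<n⇒0<n∸m i<2k)
    , subst (_< 2 * k) (sym toℕ-neg-suc) (∸-monoʳ-< 0<i (<⇒≤ i<2k))
    where
    toℕ-neg-suc : toℕ (neg [ toℕ i + 1 ]mod) ≡ 2 * k ∸ toℕ i
    toℕ-neg-suc = trans (toℕ-neg (suc-positive i<2k)) (cong (suc (2 * k) ∸_) (toℕ-[suc]mod i<2k))

  last-inner : 1 ≤ k → ∃[ j ] Inner j × toℕ j + 1 ≡ 2 * k
  last-inner 1≤k = fromℕ< (m<n⇒m<1+n t<2k)
                  , subst (λ t → 1 ≤ t × t < 2 * k) (sym toℕ-j) (∸-monoˡ-≤ 1 2≤2k , t<2k)
                  , trans (cong (_+ 1) toℕ-j) (m∸n+n≡m 1≤2k)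
    where
    2≤2k : 2 ≤ 2 * k
    2≤2k = *-monoʳ-≤ 2 1≤k
    1≤2k : 1 ≤ 2 * k
    1≤2k = <⇒≤ 2≤2k
    t<2k : 2 * k ∸ 1 < 2 * k
    t<2k = ∸-monoʳ-< (s≤s z≤n) 1≤2k
    toℕ-j : toℕ (fromℕ< (m<n⇒m<1+n t<2k)) ≡ 2 * k ∸ 1
    toℕ-j = toℕ-fromℕ< (m<n⇒m<1+n t<2k)

module _ {n : ℕ} {H : BipartiteGraph n} {k : ℕ} {u v : Fin (suc (2 * k)) → Fin n}
         (A : Asteroid H k u v) where

  open Asteroid A
  open Indices k

  v-path : ∀ i → Σ (Path H (v i) (v [ toℕ i + 1 ]mod)) λ Q →
           ∀ {w} → w ∈P Q → w ≡ v i ⊎ w ≡ v [ toℕ i + 1 ]mod ⊎ w ∈P P i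
  v-path i = extend (P i) (E-sym H (uv-edge i)) (uv-edge [ toℕ i + 1 ]mod)

  u-on-inner-path : ∀ {i} → 1 ≤ toℕ i → ∃[ j ] Inner j × u i ∈P P j
  u-on-inner-path {i} 1≤i with toℕ i <? 2 * k
  ... | yes i<2k = i , (1≤i , i<2k) , start-∈P (P i)
  ... | no i≮2k = j , inner-j , subst (_∈P P j) (cong u j+1≡i) (end-∈P (P j))
    where
    last = last-inner k≥1
    j = proj₁ last
    inner-j = proj₁ (proj₂ last)
    j+1≡i : [ toℕ j + 1 ]mod ≡ i
    j+1≡i = trans (cong [_]mod (trans (proj₂ (proj₂ last)) (≤-antisym (≮⇒≥ i≮2k) (toℕ≤pred[n] i))))
                  ([]mod-toℕ i)

  asteroid-swap : Asteroid H k v u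
  asteroid-swap = record
    { k≥1     = k≥1
    ; u-inj   = v-inj
    ; v-inj   = u-inj
    ; cls     = not cls
    ; u-side  = v-side
    ; v-side  = λ i → trans (u-side i) (sym (not-involutive cls))
    ; uv-edge = λ i → E-sym H (uv-edge i)
    ; P       = λ i → proj₁ (v-path i)
    ; cond-a  = swapped-cond-a
    ; cond-b  = swapped-cond-b
    }
    where
    far-side : ∀ i {w} → let j = [ toℕ i + k ]mod in
      (w ≡ u j ⊎ w ≡ u [ toℕ i + k + 1 ]mod) ⊎ w ∈P proj₁ (v-path j) →
      (w ≡ v j ⊎ w ≡ v [ toℕ i + k + 1 ]mod) ⊎ w ∈P P j
    far-side i (inj₁ (inj₁ refl)) = inj₂ (start-∈P (P _))
    far-side i (inj₁ (inj₂ refl)) = inj₂ (subst (_∈P P _) (cong u ([]mod-+ (toℕ i + k) 1)) (end-∈P (P _)))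
    far-side i (inj₂ w∈Q) = on-v-path (proj₂ (v-path _) w∈Q)
      where
      j = [ toℕ i + k ]mod
      on-v-path : ∀ {w} → w ≡ v j ⊎ w ≡ v [ toℕ j + 1 ]mod ⊎ w ∈P P j →
                  (w ≡ v j ⊎ w ≡ v [ toℕ i + k + 1 ]mod) ⊎ w ∈P P j
      on-v-path (inj₁ w≡vj) = inj₁ (inj₁ w≡vj)
      on-v-path (inj₂ (inj₁ refl)) = inj₁ (inj₂ (cong v ([]mod-+ (toℕ i + k) 1)))
      on-v-path (inj₂ (inj₂ w∈P)) = inj₂ w∈P
    swapped-cond-a : ∀ i → let j = [ toℕ i + k ]mod in
      NoEdges H (pair (v i) (u i))
        (λ w → (w ≡ u j ⊎ w ≡ u [ toℕ i + k + 1 ]mod) ⊎ w ∈P proj₁ (v-path j))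
    swapped-cond-a i a b a∈ b∈ = cond-a i a b (pair-swap a∈) (far-side i b∈)
    inner-side : ∀ {w} →
        (Σ (Fin (suc (2 * k))) λ i → 1 ≤ toℕ i × w ≡ u i)
      ⊎ (Σ (Fin (suc (2 * k))) λ i → Inner i × w ∈P proj₁ (v-path i)) →
        (Σ (Fin (suc (2 * k))) λ i → 1 ≤ toℕ i × w ≡ v i)
      ⊎ (Σ (Fin (suc (2 * k))) λ i → Inner i × w ∈P P i)
    inner-side (inj₁ (i , 1≤i , refl)) = inj₂ (u-on-inner-path 1≤i)
    inner-side (inj₂ (i , inner-i , w∈Q)) = on-v-path (proj₂ (v-path i) w∈Q)
      where
      on-v-path : ∀ {w} → w ≡ v i ⊎ w ≡ v [ toℕ i + 1 ]mod ⊎ w ∈P P i →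
                  (Σ (Fin (suc (2 * k))) λ i → 1 ≤ toℕ i × w ≡ v i)
                  ⊎ (Σ (Fin (suc (2 * k))) λ i → Inner i × w ∈P P i)
      on-v-path (inj₁ w≡vi) = inj₁ (i , proj₁ inner-i , w≡vi)
      on-v-path (inj₂ (inj₁ w≡vi+1)) = inj₁ (_ , suc-positive (proj₂ inner-i) , w≡vi+1)
      on-v-path (inj₂ (inj₂ w∈P)) = inj₂ (i , inner-i , w∈P)
    swapped-cond-b : NoEdges H (pair (v [ 0 ]mod) (u [ 0 ]mod))
      (λ w → (Σ (Fin (suc (2 * k))) λ i → 1 ≤ toℕ i × w ≡ u i)
           ⊎ (Σ (Fin (suc (2 * k))) λ i → Inner i × w ∈P proj₁ (v-path i)))
    swapped-cond-b a b a∈ b∈ = cond-b a b (pair-swap a∈) (inner-side b∈)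

  reversed-path : ∀ i → PathWithin (P (neg [ toℕ i + 1 ]mod)) (u (neg i)) (u (neg [ toℕ i + 1 ]mod))
  reversed-path i = subst (λ z → PathWithin (P (neg [ toℕ i + 1 ]mod)) (u z) (u (neg [ toℕ i + 1 ]mod)))
                          (neg-suc i) (reverse (P (neg [ toℕ i + 1 ]mod)))

  asteroid-reverse : Asteroid H k (u ∘ neg) (v ∘ neg)
  asteroid-reverse = record
    { k≥1     = k≥1
    ; u-inj   = neg-injective ∘ u-inj
    ; v-inj   = neg-injective ∘ v-inj
    ; cls     = cls
    ; u-side  = u-side ∘ neg
    ; v-side  = v-side ∘ neg
    ; uv-edge = uv-edge ∘ neg
    ; P       = λ i → proj₁ (reversed-path i)
    ; cond-a  = reversed-cond-a
    ; cond-b  = reversed-cond-b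
    }
    where
    far-side : ∀ i {w} → let j = [ toℕ i + k ]mod ; i′ = toℕ (neg i) in
      (w ≡ v (neg j) ⊎ w ≡ v (neg [ toℕ i + k + 1 ]mod)) ⊎ w ∈P proj₁ (reversed-path j) →
      (w ≡ v [ i′ + k ]mod ⊎ w ≡ v [ i′ + k + 1 ]mod) ⊎ w ∈P P [ i′ + k ]mod
    far-side i (inj₁ (inj₁ w≡v)) = inj₁ (inj₂ (trans w≡v (cong v (neg-+k i))))
    far-side i (inj₁ (inj₂ w≡v)) = inj₁ (inj₁ (trans w≡v (cong v (neg-+k+1 i))))
    far-side i (inj₂ w∈Q) = inj₂ (subst (λ z → _ ∈P P z) path-index (proj₂ (reversed-path [ toℕ i + k ]mod) w∈Q))
      where
      path-index : neg [ toℕ ([_]mod {2 * k} (toℕ i + k)) + 1 ]mod ≡ [ toℕ (neg i) + k ]mod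
      path-index = trans (cong neg ([]mod-+ (toℕ i + k) 1)) (neg-+k+1 i)
    reversed-cond-a : ∀ i → let j = [ toℕ i + k ]mod in
      NoEdges H (pair (u (neg i)) (v (neg i)))
        (λ w → (w ≡ v (neg j) ⊎ w ≡ v (neg [ toℕ i + k + 1 ]mod)) ⊎ w ∈P proj₁ (reversed-path j))
    reversed-cond-a i a b a∈ b∈ = cond-a (neg i) a b a∈ (far-side i b∈)
    inner-side : ∀ {w} →
        (Σ (Fin (suc (2 * k))) λ i → 1 ≤ toℕ i × w ≡ v (neg i))
      ⊎ (Σ (Fin (suc (2 * k))) λ i → Inner i × w ∈P proj₁ (reversed-path i)) →
        (Σ (Fin (suc (2 * k))) λ i → 1 ≤ toℕ i × w ≡ v i)
      ⊎ (Σ (Fin (suc (2 * k))) λ i → Inner i × w ∈P P i)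
    inner-side (inj₁ (i , 1≤i , w≡v)) = inj₁ (neg i , neg-positive 1≤i , w≡v)
    inner-side (inj₂ (i , inner-i , w∈Q)) = inj₂ (neg [ toℕ i + 1 ]mod , neg-inner inner-i , proj₂ (reversed-path i) w∈Q)
    reversed-cond-b : NoEdges H (pair (u (neg [ 0 ]mod)) (v (neg [ 0 ]mod)))
      (λ w → (Σ (Fin (suc (2 * k))) λ i → 1 ≤ toℕ i × w ≡ v (neg i))
           ⊎ (Σ (Fin (suc (2 * k))) λ i → Inner i × w ∈P proj₁ (reversed-path i)))
    reversed-cond-b a b a∈ b∈ =
      cond-b a b (subst (λ z → pair (u z) (v z) a) neg-0 a∈) (inner-side b∈)

  asteroid-triple : SpecialTriple H (u [ 0 ]mod) (u [ 1 ]mod) (u [ k + 1 ]mod)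
  asteroid-triple = k , u , v , A , same-triple refl refl refl

  reversed-triple : SpecialTriple H (u [ 0 ]mod) (u [ 2 * k ]mod) (u [ k ]mod)
  reversed-triple = k , u ∘ neg , v ∘ neg , asteroid-reverse
                  , same-triple (cong u (sym neg-0)) (cong u (sym neg-1)) (cong u (sym neg-k+1))

proposition4p8 : ∀ {n : ℕ} (H : BipartiteGraph n) (k : ℕ)
    (u v : Fin (suc (2 * k)) → Fin n) →
    Asteroid H k u v →
    SpecialTriple H (u [ 0 ]mod) (u [ 1 ]mod) (u [ k + 1 ]mod)
    × SpecialTriple H (u [ 0 ]mod) (u [ 2 * k ]mod) (u [ k ]mod)
    × SpecialTriple H (v [ 0 ]mod) (v [ 1 ]mod) (v [ k + 1 ]mod)
    × SpecialTriple H (v [ 0 ]mod) (v [ 2 * k ]mod) (v [ k ]mod)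
proposition4p8 H k u v A =
  asteroid-triple A , reversed-triple A , asteroid-triple (asteroid-swap A) , reversed-triple (asteroid-swap A)
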